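{- Let $\mathcal{E}$ be a regular bundle event structure. If a configuration $x\in\mathcal{C}(\mathcal{E})$ contains a final event, i.e. $x\cap\Phi_\mathcal{E}\neq\emptyset$, then $x$ is maximal in $\mathcal{C}(\mathcal{E})$ with respect to inclusion.
   Context: A bundle event structure (BES) over actions $\Sigma$ is $\mathcal{E}=(E,\#,\mapsto,\lambda,\Phi)$: events $E$; $\#\subseteq E\times E$ irreflexive symmetric; $x\#y$ for sets means $e\#f$ for all distinct $e\in x,f\in y$; bundles $\mapsto\subseteq\mathcal{P}(E)\times E$ with $x\mapsto e\Rightarrow x\#x$; partial labelling $\lambda$; final events $\Phi\subseteq E$ with $\Phi\#\Phi$. $\mathrm{cfl}(x)=\{e\mid\exists e'\in x:e\#e'\}$. An event trace is a finite sequence $e_1\cdots e_n$ with, for each $i$, $e_i\notin\mathrm{cfl}(\{e_1,..,e_{i-1}\})\cup\{e_1,..,e_{i-1}\}$ and for each bundle $z\mapsto e_i$ some $j<i$ with $e_j\in z$; a configuration is the event set of an event trace; $\mathcal{C}(\mathcal{E})$ is the set of configurations. $\mathrm{init}(\mathcal{E})$ is the set of events pointed to by no bundle. Regular BES are those built from the basic BES $0=(\emptyset,\emptyset,\emptyset,\emptyset,\emptyset)$, $1=(\{e\},\emptyset,\emptyset,\emptyset,\{e\})$ and $a=(\{e_a\},\emptyset,\emptyset,\lambda(e_a)=a,\{e_a\})$ for $a\in\Sigma$, using the operations (on operands with disjoint events): $\mathcal{E}\|\mathcal{F}$ with events $E\cup F\cup\{e,f\}$ ($e,f$ fresh, unlabelled),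 conflicts $\#_\mathcal{E}\cup\#_\mathcal{F}$, bundles $\mapsto_\mathcal{E}\cup\mapsto_\mathcal{F}\cup\{\{e\}\mapsto e'\mid e'\in\mathrm{init}(\mathcal{E})\cup\mathrm{init}(\mathcal{F})\}\cup\{\Phi_\mathcal{E}\mapsto f,\Phi_\mathcal{F}\mapsto f\}$, final events $\{f\}$; $\mathcal{E}\cdot\mathcal{F}$ with events $E\cup F$, conflicts $\#_\mathcal{E}\cup\#_\mathcal{F}$, bundles $\mapsto_\mathcal{E}\cup\mapsto_\mathcal{F}\cup\{\Phi_\mathcal{E}\mapsto e\mid e\in\mathrm{init}(\mathcal{F})\}$, final events $\Phi_\mathcal{F}$; $\mathcal{E}+\mathcal{F}$ with events $E\cup F$, conflicts $\#_\mathcal{E}\cup\#_\mathcal{F}$ plus the symmetric closures of $\mathrm{init}(\mathcal{E})\times\mathrm{init}(\mathcal{F})$ and $\Phi_\mathcal{E}\times\Phi_\mathcal{F}$, bundles $\mapsto_\mathcal{E}\cup\mapsto_\mathcal{F}$, final events $\Phi_\mathcal{E}\cup\Phi_\mathcal{F}$ (labellings are unions throughout); and $\mathcal{E}*\mathcal{F}$, the least upper bound (componentwise union) with respect to the sub-BES order of the chain $\mathcal{F}\trianglelefteq\mathcal{F}+\mathcal{E}\cdot\mathcal{F}\trianglelefteq\mathcal{F}+\mathcal{E}\cdot(\mathcal{F}+\mathcal{E}\cdot\mathcal{F})\trianglelefteq\cdots$ with fresh copies of events at each unfolding, renamed so that each term is a sub-BES of the next. (Sub-BES: $\mathcal{E}\trianglelefteq\mathcal{F}$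 iff $E\subseteq F$, $\#_\mathcal{E}=\#_\mathcal{F}\cap(E\times E)$, $\mapsto_\mathcal{E}\subseteq\mapsto_\mathcal{F}$, ($x\mapsto_\mathcal{F}e$, $e\in E$) implies ($x\subseteq E$, $x\mapsto_\mathcal{E}e$), $\lambda_\mathcal{E}=\lambda_\mathcal{F}|_E$, $\Phi_\mathcal{E}=\Phi_\mathcal{F}\cap E$.) -}

module Defs where

open import Data.Nat using (ℕ; suc)
open import Data.Unit using (⊤; tt)
open import Data.Empty using (⊥)
open import Data.Maybe using (Maybe; just; nothing)
open import Data.Product using (Σ; ∃; _×_; _,_)
open import Data.Sum using (_⊎_; inj₁; inj₂)
open import Data.List using (List; []; _∷_)
open import Data.List.Membership.Propositional using (_∈_; _∉_)
open import Relation.Nullary using (¬_)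
open import Relation.Binary.PropositionalEquality using (_≡_; _≢_)

-- The bundle relation
-- ↦ ⊆ P(E) × E is represented by an index type Bun of bundles, each
-- bundle b being  src b ↦ tgt b.

record BES (A : Set) : Set₁ where
  field
    Ev   : Set
    _#_  : Ev → Ev → Set
    Bun  : Set
    src  : Bun → Ev → Set
    tgt  : Bun → Ev
    lab  : Ev → Maybe A
    fin  : Ev → Set

  init : Ev → Set
  init e = (b : Bun) → tgt b ≢ e

  Enabled : List Ev → Ev → Set
  Enabled xs e =
      e ∉ xs
    × ((e' : Ev) → e' ∈ xs → ¬ (e # e'))
    × ((b : Bun) → tgt b ≡ e → ∃ λ e' → e' ∈ xs × src b e')

  -- Event traces, stored in reverse order (last event at the head).
  data Trace : List Ev → Set where
    []  : Trace []
    _▷_ : ∀ {xs e} → Trace xs → Enabled xs e → Trace (e ∷ xs)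

  IsConfig : (Ev → Set) → Set
  IsConfig x = ∃ λ xs → Trace xs × ((e : Ev) → (x e → e ∈ xs) × (e ∈ xs → x e))

  MaximalConfig : (Ev → Set) → Set₁
  MaximalConfig x = IsConfig x ×
    ((y : Ev → Set) → IsConfig y → ((e : Ev) → x e → y e) → (e : Ev) → y e → x e)

open BES

zeroB : ∀ {A} → BES A
zeroB = record { Ev = ⊥ ; _#_ = λ _ _ → ⊥ ; Bun = ⊥ ; src = λ () ; tgt = λ ()
               ; lab = λ () ; fin = λ () }

oneB : ∀ {A} → BES A
oneB = record { Ev = ⊤ ; _#_ = λ _ _ → ⊥ ; Bun = ⊥ ; src = λ () ; tgt = λ ()
              ; lab = λ _ → nothing ; fin = λ _ → ⊤ }

actB : ∀ {A} → A → BES A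
actB a = record { Ev = ⊤ ; _#_ = λ _ _ → ⊥ ; Bun = ⊥ ; src = λ () ; tgt = λ ()
                ; lab = λ _ → just a ; fin = λ _ → ⊤ }

-- Parallel composition  E ‖ F  (fresh unlabelled events start (= e), end (= f))

data ParEv (X Y : Set) : Set where
  pl    : X → ParEv X Y
  pr    : Y → ParEv X Y
  start : ParEv X Y
  end   : ParEv X Y

module _ {A : Set} (E F : BES A) where

  private
    module E = BES E
    module F = BES F

  parConf : ParEv E.Ev F.Ev → ParEv E.Ev F.Ev → Set
  parConf (pl e) (pl e') = E._#_ e e'
  parConf (pr f) (pr f') = F._#_ f f'
  parConf _      _       = ⊥

  data ParBun : Set where
    bl      : E.Bun → ParBun
    br      : F.Bun → ParBun
    startl  : (e : E.Ev) → E.init e → ParBun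
    startr  : (f : F.Ev) → F.init f → ParBun
    endl    : ParBun
    endr    : ParBun

  parSrc : ParBun → ParEv E.Ev F.Ev → Set
  parSrc (bl b)       (pl e) = E.src b e
  parSrc (bl b)       _      = ⊥
  parSrc (br b)       (pr f) = F.src b f
  parSrc (br b)       _      = ⊥
  parSrc (startl _ _) x      = x ≡ start
  parSrc (startr _ _) x      = x ≡ start
  parSrc endl         (pl e) = E.fin e
  parSrc endl         _      = ⊥
  parSrc endr         (pr f) = F.fin f
  parSrc endr         _      = ⊥

  parTgt : ParBun → ParEv E.Ev F.Ev
  parTgt (bl b)       = pl (E.tgt b)
  parTgt (br b)       = pr (F.tgt b)
  parTgt (startl e _) = pl e
  parTgt (startr f _) = pr f
  parTgt endl         = end
  parTgt endr         = end

  parLab : ParEv E.Ev F.Ev → Maybe A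
  parLab (pl e) = E.lab e
  parLab (pr f) = F.lab f
  parLab start  = nothing
  parLab end    = nothing

  parB : BES A
  parB = record { Ev = ParEv E.Ev F.Ev ; _#_ = parConf ; Bun = ParBun
                ; src = parSrc ; tgt = parTgt ; lab = parLab ; fin = λ x → x ≡ end }

  liftConf : E.Ev ⊎ F.Ev → E.Ev ⊎ F.Ev → Set
  liftConf (inj₁ e) (inj₁ e') = E._#_ e e'
  liftConf (inj₂ f) (inj₂ f') = F._#_ f f'
  liftConf _        _         = ⊥

  sumLab : E.Ev ⊎ F.Ev → Maybe A
  sumLab (inj₁ e) = E.lab e
  sumLab (inj₂ f) = F.lab f

  sumFin : E.Ev ⊎ F.Ev → Set
  sumFin (inj₁ e) = E.fin e
  sumFin (inj₂ f) = F.fin f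

  data SeqBun : Set where
    sl   : E.Bun → SeqBun
    sr   : F.Bun → SeqBun
    link : (f : F.Ev) → F.init f → SeqBun

  seqSrc : SeqBun → E.Ev ⊎ F.Ev → Set
  seqSrc (sl b)     (inj₁ e) = E.src b e
  seqSrc (sl b)     (inj₂ _) = ⊥
  seqSrc (sr b)     (inj₁ _) = ⊥
  seqSrc (sr b)     (inj₂ f) = F.src b f
  seqSrc (link _ _) (inj₁ e) = E.fin e
  seqSrc (link _ _) (inj₂ _) = ⊥

  seqTgt : SeqBun → E.Ev ⊎ F.Ev
  seqTgt (sl b)     = inj₁ (E.tgt b)
  seqTgt (sr b)     = inj₂ (F.tgt b)
  seqTgt (link f _) = inj₂ f

  seqB : BES A
  seqB = record { Ev = E.Ev ⊎ F.Ev ; _#_ = liftConf ; Bun = SeqBun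
                ; src = seqSrc ; tgt = seqTgt ; lab = sumLab
                ; fin = λ { (inj₁ _) → ⊥ ; (inj₂ f) → F.fin f } }

  altConf : E.Ev ⊎ F.Ev → E.Ev ⊎ F.Ev → Set
  altConf (inj₁ e) (inj₁ e') = E._#_ e e'
  altConf (inj₂ f) (inj₂ f') = F._#_ f f'
  altConf (inj₁ e) (inj₂ f)  = (E.init e × F.init f) ⊎ (E.fin e × F.fin f)
  altConf (inj₂ f) (inj₁ e)  = (E.init e × F.init f) ⊎ (E.fin e × F.fin f)

  altSrc : E.Bun ⊎ F.Bun → E.Ev ⊎ F.Ev → Set
  altSrc (inj₁ b) (inj₁ e) = E.src b e
  altSrc (inj₁ b) (inj₂ _) = ⊥
  altSrc (inj₂ b) (inj₁ _) = ⊥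
  altSrc (inj₂ b) (inj₂ f) = F.src b f

  altTgt : E.Bun ⊎ F.Bun → E.Ev ⊎ F.Ev
  altTgt (inj₁ b) = inj₁ (E.tgt b)
  altTgt (inj₂ b) = inj₂ (F.tgt b)

  altB : BES A
  altB = record { Ev = E.Ev ⊎ F.Ev ; _#_ = altConf ; Bun = E.Bun ⊎ F.Bun
                ; src = altSrc ; tgt = altTgt ; lab = sumLab ; fin = sumFin }

-- Iteration E * F: the least upper bound (componentwise union) of the chain
--   U₀ = F,  U_{n+1} = F + E · U_n.
-- An event of the union is a copy of an event of E or of F at unfolding
-- depth d: depth d means that the copy lies under d occurrences of "E ·".
-- (Each U_n consists of the F-copies of depth ≤ n and the E-copies of
-- depth < n; the components below are exactly the unions over n.)

  data StarEv : Set where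
    cE : ℕ → E.Ev → StarEv
    cF : ℕ → F.Ev → StarEv

  starConf : StarEv → StarEv → Set
  starConf (cE d e) (cE d' e') = d ≡ d' × E._#_ e e'
  starConf (cF d f) (cF d' f') = (d ≡ d' × F._#_ f f') ⊎ (d ≢ d' × F.fin f × F.fin f')
  starConf (cE d e) (cF d' f)  = d ≡ d' × E.init e × F.init f
  starConf (cF d f) (cE d' e)  = d ≡ d' × E.init e × F.init f

  data StarBun : Set where
    bE    : ℕ → E.Bun → StarBun
    bF    : ℕ → F.Bun → StarBun
    linkF : ℕ → (f : F.Ev) → F.init f → StarBun
    linkE : ℕ → (e : E.Ev) → E.init e → StarBun

  starSrc : StarBun → StarEv → Set
  starSrc (bE d b)      (cE d' e) = d ≡ d' × E.src b e
  starSrc (bE d b)      (cF _ _)  = ⊥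
  starSrc (bF d b)      (cE _ _)  = ⊥
  starSrc (bF d b)      (cF d' f) = d ≡ d' × F.src b f
  starSrc (linkF d _ _) (cE d' e) = d ≡ d' × E.fin e
  starSrc (linkF d _ _) (cF _ _)  = ⊥
  starSrc (linkE d _ _) (cE d' e) = d ≡ d' × E.fin e
  starSrc (linkE d _ _) (cF _ _)  = ⊥

  starTgt : StarBun → StarEv
  starTgt (bE d b)      = cE d (E.tgt b)
  starTgt (bF d b)      = cF d (F.tgt b)
  starTgt (linkF d f _) = cF (suc d) f
  starTgt (linkE d e _) = cE (suc d) e

  starLab : StarEv → Maybe A
  starLab (cE _ e) = E.lab e
  starLab (cF _ f) = F.lab f

  starFin : StarEv → Set
  starFin (cE _ _) = ⊥
  starFin (cF _ f) = F.fin f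

  starB : BES A
  starB = record { Ev = StarEv ; _#_ = starConf ; Bun = StarBun
                 ; src = starSrc ; tgt = starTgt ; lab = starLab ; fin = starFin }

data RegExp (A : Set) : Set where
  𝟘 𝟙  : RegExp A
  act  : A → RegExp A
  _‖_ _·_ _⊕_ _⊛_ : RegExp A → RegExp A → RegExp A

⟦_⟧ : ∀ {A} → RegExp A → BES A
⟦ 𝟘 ⟧     = zeroB
⟦ 𝟙 ⟧     = oneB
⟦ act a ⟧ = actB a
⟦ r ‖ s ⟧ = parB ⟦ r ⟧ ⟦ s ⟧
⟦ r · s ⟧ = seqB ⟦ r ⟧ ⟦ s ⟧
⟦ r ⊕ s ⟧ = altB ⟦ r ⟧ ⟦ s ⟧
⟦ r ⊛ s ⟧ = starB ⟦ r ⟧ ⟦ s ⟧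

module Submission where

-- We work with event traces (lists of events, most recent first) and prove
-- the trace form of the statement, FinalMaximal: a trace containing a final
-- event covers every trace extending it.  The proof is by induction on the
-- regular expression.  The key tool is an embedding of a component BES into
-- a composite one: restricting a trace of the composite to the component
-- gives a trace of the component, so maximality of the component restriction
-- (the induction hypothesis) controls all component events of an extension
-- (maximalOnImage).  Events outside the components are handled by three
-- observations about traces: every bundle of a traced event is satisfied in
-- the trace (this brings in the final events of the operands of ‖ and ·,
-- and the final E-events below a copy in E * F), every nonempty component
-- restriction contains an initial event, and a trace never contains two
-- events in mutual conflict (so the two sides of + and the E- and F-copies
-- at one depth of E * F exclude each other).

open import Defs
open import Data.Product using (∃; _×_; Σ; _,_; proj₁; proj₂)
open import Data.Nat using (ℕ; suc; _<_; s≤s)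
open import Data.Nat.Properties using (_≟_; <-cmp; m≤n⇒m<n∨m≡n)
open import Data.Empty using (⊥; ⊥-elim)
open import Data.Maybe using (Maybe; just; nothing)
open import Data.Sum using (_⊎_; inj₁; inj₂)
open import Data.List using (List; []; _∷_)
open import Data.List.Relation.Unary.Any using (here; there)
open import Data.List.Membership.Propositional using (_∈_)
open import Data.List.Relation.Binary.Subset.Propositional using (_⊆_)
open import Relation.Nullary using (yes; no)
open import Relation.Binary using (tri<; tri≈; tri>)
open import Relation.Binary.PropositionalEquality using (_≡_; _≢_; refl; sym; subst)

module TraceFacts {A : Set} (B : BES A) where
  open BES B

  bundleSatisfied : ∀ {xs} → Trace xs → ∀ {e} → e ∈ xs → (b : Bun) → tgt b ≡ e →
                    ∃ λ e' → e' ∈ xs × src b e'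
  bundleSatisfied (_ ▷ (_ , _ , bundles)) (here refl) b eq with bundles b eq
  ... | e' , e'In , s = e' , there e'In , s
  bundleSatisfied (t ▷ _) (there eIn) b eq with bundleSatisfied t eIn b eq
  ... | e' , e'In , s = e' , there e'In , s

  -- The first event of a nonempty trace is initial: no bundle points to it.
  initialEvent : ∀ {xs} → Trace xs → ∀ {e} → e ∈ xs → ∃ λ e' → e' ∈ xs × init e'
  initialEvent (_▷_ {[]} {e} _ (_ , _ , bundles)) _ =
    e , here refl , λ b eq → noneInEmpty (bundles b eq)
    where
      noneInEmpty : ∀ {P : Ev → Set} → ∃ (λ e' → e' ∈ [] × P e') → ⊥
      noneInEmpty (_ , () , _)
  initialEvent (_▷_ {_ ∷ _} t _) _ with initialEvent t (here refl)
  ... | e' , e'In , i = e' , there e'In , i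

  conflictFree : ∀ {xs} → Trace xs → ∀ {a b} → a ∈ xs → b ∈ xs → a # b → b # a → a ≡ b
  conflictFree (_ ▷ _) (here refl) (here refl) _ _ = refl
  conflictFree (_ ▷ (_ , noConflict , _)) (here refl) (there bIn) ab _ =
    ⊥-elim (noConflict _ bIn ab)
  conflictFree (_ ▷ (_ , noConflict , _)) (there aIn) (here refl) _ ba =
    ⊥-elim (noConflict _ aIn ba)
  conflictFree (t ▷ _) (there aIn) (there bIn) ab ba = conflictFree t aIn bIn ab ba

open TraceFacts

MaximalTrace : ∀ {A} (B : BES A) → List (BES.Ev B) → Set
MaximalTrace B xs = ∀ {ys} → BES.Trace B ys → xs ⊆ ys → ys ⊆ xs

FinalMaximal : ∀ {A} (B : BES A) → Set
FinalMaximal B = ∀ {xs} → BES.Trace B xs → (∃ λ e → e ∈ xs × BES.fin B e) →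
                 MaximalTrace B xs

record Embedding {A : Set} (B C : BES A) : Set where
  field
    ι      : BES.Ev C → BES.Ev B
    proj   : BES.Ev B → Maybe (BES.Ev C)
    proj-ι : ∀ c → proj (ι c) ≡ just c
    ι-proj : ∀ e c → proj e ≡ just c → ι c ≡ e
    conf   : ∀ a b → BES._#_ C a b → BES._#_ B (ι a) (ι b)
    bun    : (b : BES.Bun C) → Σ (BES.Bun B) λ b' → BES.tgt B b' ≡ ι (BES.tgt C b) ×
               (∀ e → BES.src B b' e → ∃ λ c → proj e ≡ just c × BES.src C b c)

module Restriction {A : Set} {B C : BES A} (em : Embedding B C) where
  open Embedding em
  private
    module B = BES B
    module C = BES C

  restrict : List B.Ev → List C.Ev
  restrict [] = []
  restrict (e ∷ xs) with proj e
  ... | just c  = c ∷ restrict xs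
  ... | nothing = restrict xs

  ∈-restrict⁻ : ∀ xs {c} → c ∈ restrict xs → ι c ∈ xs
  ∈-restrict⁻ (e ∷ xs) m with proj e in eq
  ∈-restrict⁻ (e ∷ xs) (here refl) | just c = here (ι-proj e c eq)
  ∈-restrict⁻ (e ∷ xs) (there m)   | just _ = there (∈-restrict⁻ xs m)
  ∈-restrict⁻ (e ∷ xs) m           | nothing = there (∈-restrict⁻ xs m)

  ∈-restrict⁺ : ∀ xs {c} → ι c ∈ xs → c ∈ restrict xs
  ∈-restrict⁺ (_ ∷ xs) {c} (here refl) rewrite proj-ι c = here refl
  ∈-restrict⁺ (e ∷ xs) (there m) with proj e
  ... | just _  = there (∈-restrict⁺ xs m)
  ... | nothing = ∈-restrict⁺ xs m

  restrictEnabled : ∀ {xs c} → B.Enabled xs (ι c) → C.Enabled (restrict xs) c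
  restrictEnabled {xs} {c} (fresh , noConflict , bundles) =
    (λ m → fresh (∈-restrict⁻ xs m)) ,
    (λ c' m cc → noConflict (ι c') (∈-restrict⁻ xs m) (conf c c' cc)) ,
    satisfied
    where
      satisfied : ∀ b → C.tgt b ≡ c → ∃ λ c' → c' ∈ restrict xs × C.src b c'
      satisfied b refl with bun b
      ... | b' , tgtEq , srcProj with bundles b' tgtEq
      ... | e' , e'In , s with srcProj e' s
      ... | c' , eq , s' = c' , ∈-restrict⁺ xs (subst (_∈ xs) (sym (ι-proj e' c' eq)) e'In) , s'

  restrictTrace : ∀ {xs} → B.Trace xs → C.Trace (restrict xs)
  restrictTrace B.[] = C.[]
  restrictTrace (B._▷_ {xs} {e} t en) with proj e in eq
  ... | nothing = restrictTrace t
  ... | just c  = restrictTrace t C.▷ restrictEnabled (subst (B.Enabled xs) (sym (ι-proj e c eq)) en)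

  initialInImage : ∀ {xs} → B.Trace xs → ∀ {c} → ι c ∈ xs → ∃ λ c' → ι c' ∈ xs × C.init c'
  initialInImage {xs} t cIn with initialEvent C (restrictTrace t) (∈-restrict⁺ xs cIn)
  ... | c' , c'In , i = c' , ∈-restrict⁻ xs c'In , i

  maximalOnImage : FinalMaximal C → ∀ {xs} → B.Trace xs → (∃ λ c → ι c ∈ xs × C.fin c) →
                   ∀ {ys} → B.Trace ys → xs ⊆ ys → ∀ {c} → ι c ∈ ys → ι c ∈ xs
  maximalOnImage maxC {xs} t (c , cIn , finC) {ys} ty xs⊆ys m =
    ∈-restrict⁻ xs (maxC (restrictTrace t) (c , ∈-restrict⁺ xs cIn , finC)
                         (restrictTrace ty) restricted⊆ (∈-restrict⁺ ys m))
    where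
      restricted⊆ : restrict xs ⊆ restrict ys
      restricted⊆ c'In = ∈-restrict⁺ ys (xs⊆ys (∈-restrict⁻ xs c'In))

open Restriction

exclusiveImages : ∀ {A} {B C D : BES A} (em₁ : Embedding B C) (em₂ : Embedding B D) →
  (∀ {c d} → BES.init C c → BES.init D d →
     BES._#_ B (Embedding.ι em₁ c) (Embedding.ι em₂ d) ×
     BES._#_ B (Embedding.ι em₂ d) (Embedding.ι em₁ c)) →
  (∀ {c d} → Embedding.ι em₁ c ≢ Embedding.ι em₂ d) →
  ∀ {ys} → BES.Trace B ys → ∀ {c d} →
  Embedding.ι em₁ c ∈ ys → Embedding.ι em₂ d ∈ ys → ⊥
exclusiveImages {B = B} em₁ em₂ initConflict disjoint ty cIn dIn
  with initialInImage em₁ ty cIn | initialInImage em₂ ty dIn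
... | c' , c'In , ic | d' , d'In , id =
  disjoint (conflictFree B ty c'In d'In (proj₁ (initConflict ic id)) (proj₂ (initConflict ic id)))

module Embeddings {A : Set} (E F : BES A) where
  private
    module E = BES E
    module F = BES F

  projPl : ParEv E.Ev F.Ev → Maybe E.Ev
  projPl (pl e) = just e
  projPl _      = nothing

  projPr : ParEv E.Ev F.Ev → Maybe F.Ev
  projPr (pr f) = just f
  projPr _      = nothing

  embPL : Embedding (parB E F) E
  embPL = record
    { ι = pl ; proj = projPl ; proj-ι = λ _ → refl
    ; ι-proj = λ { (pl e) c refl → refl ; (pr _) c () ; start c () ; end c () }
    ; conf = λ _ _ c → c
    ; bun = λ b → bl b , refl , λ { (pl e) s → e , refl , s ; (pr _) () ; start () ; end () } }

  embPR : Embedding (parB E F) F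
  embPR = record
    { ι = pr ; proj = projPr ; proj-ι = λ _ → refl
    ; ι-proj = λ { (pr f) c refl → refl ; (pl _) c () ; start c () ; end c () }
    ; conf = λ _ _ c → c
    ; bun = λ b → br b , refl , λ { (pr f) s → f , refl , s ; (pl _) () ; start () ; end () } }

  projInj₁ : E.Ev ⊎ F.Ev → Maybe E.Ev
  projInj₁ (inj₁ e) = just e
  projInj₁ (inj₂ _) = nothing

  projInj₂ : E.Ev ⊎ F.Ev → Maybe F.Ev
  projInj₂ (inj₁ _) = nothing
  projInj₂ (inj₂ f) = just f

  embSL : Embedding (seqB E F) E
  embSL = record
    { ι = inj₁ ; proj = projInj₁ ; proj-ι = λ _ → refl
    ; ι-proj = λ { (inj₁ e) c refl → refl ; (inj₂ _) c () }
    ; conf = λ _ _ c → c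
    ; bun = λ b → sl b , refl , λ { (inj₁ e) s → e , refl , s ; (inj₂ _) () } }

  embSR : Embedding (seqB E F) F
  embSR = record
    { ι = inj₂ ; proj = projInj₂ ; proj-ι = λ _ → refl
    ; ι-proj = λ { (inj₂ f) c refl → refl ; (inj₁ _) c () }
    ; conf = λ _ _ c → c
    ; bun = λ b → sr b , refl , λ { (inj₂ f) s → f , refl , s ; (inj₁ _) () } }

  embAL : Embedding (altB E F) E
  embAL = record
    { ι = inj₁ ; proj = projInj₁ ; proj-ι = λ _ → refl
    ; ι-proj = λ { (inj₁ e) c refl → refl ; (inj₂ _) c () }
    ; conf = λ _ _ c → c
    ; bun = λ b → inj₁ b , refl , λ { (inj₁ e) s → e , refl , s ; (inj₂ _) () } }

  embAR : Embedding (altB E F) F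
  embAR = record
    { ι = inj₂ ; proj = projInj₂ ; proj-ι = λ _ → refl
    ; ι-proj = λ { (inj₂ f) c refl → refl ; (inj₁ _) c () }
    ; conf = λ _ _ c → c
    ; bun = λ b → inj₂ b , refl , λ { (inj₂ f) s → f , refl , s ; (inj₁ _) () } }

  atDepth : ∀ {X : Set} → ℕ → ℕ → X → Maybe X
  atDepth k d x with d ≟ k
  ... | yes _ = just x
  ... | no _  = nothing

  atDepth-self : ∀ {X : Set} k (x : X) → atDepth k k x ≡ just x
  atDepth-self k x with k ≟ k
  ... | yes _  = refl
  ... | no k≢k = ⊥-elim (k≢k refl)

  atDepth-just : ∀ {X : Set} {k d} {x y : X} → atDepth k d x ≡ just y → d ≡ k × x ≡ y
  atDepth-just {k = k} {d} eq with d ≟ k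
  atDepth-just refl | yes d≡k = d≡k , refl
  atDepth-just ()   | no _

  projCE : ℕ → StarEv E F → Maybe E.Ev
  projCE k (cE d e) = atDepth k d e
  projCE k (cF _ _) = nothing

  projCF : ℕ → StarEv E F → Maybe F.Ev
  projCF k (cE _ _) = nothing
  projCF k (cF d f) = atDepth k d f

  ι-projCE : ∀ k e c → projCE k e ≡ just c → cE k c ≡ e
  ι-projCE k (cE d e) c eq with atDepth-just eq
  ... | refl , refl = refl

  ι-projCF : ∀ k e c → projCF k e ≡ just c → cF k c ≡ e
  ι-projCF k (cF d f) c eq with atDepth-just eq
  ... | refl , refl = refl

  embStE : ℕ → Embedding (starB E F) E
  embStE k = record
    { ι = cE k ; proj = projCE k ; proj-ι = atDepth-self k ; ι-proj = ι-projCE k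
    ; conf = λ _ _ c → refl , c
    ; bun = λ b → bE k b , refl ,
              λ { (cE .k e) (refl , s) → e , atDepth-self k e , s ; (cF _ _) () } }

  embStF : ℕ → Embedding (starB E F) F
  embStF k = record
    { ι = cF k ; proj = projCF k ; proj-ι = atDepth-self k ; ι-proj = ι-projCF k
    ; conf = λ _ _ c → inj₁ (refl , c)
    ; bun = λ b → bF k b , refl ,
              λ { (cF .k f) (refl , s) → f , atDepth-self k f , s ; (cE _ _) () } }

module Compositions {A : Set} (E F : BES A) (maxE : FinalMaximal E) (maxF : FinalMaximal F) where
  open Embeddings E F
  private
    module E = BES E
    module F = BES F

  -- The final event of E ‖ F is its end event, whose two bundles {Φ_E ↦ end,
  -- Φ_F ↦ end} bring in final events of both operands; the start event is
  -- present because the initial E-event needs it.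
  parallelCase : FinalMaximal (parB E F)
  parallelCase {xs} t (.end , endIn , refl) {ys} ty xs⊆ys = covers
    where
      finalLeft : ∃ λ a → pl a ∈ xs × E.fin a
      finalLeft with bundleSatisfied (parB E F) t endIn endl refl
      ... | pl a , aIn , finA = a , aIn , finA
      ... | pr _ , _ , ()
      ... | start , _ , ()
      ... | end , _ , ()

      finalRight : ∃ λ b → pr b ∈ xs × F.fin b
      finalRight with bundleSatisfied (parB E F) t endIn endr refl
      ... | pr b , bIn , finB = b , bIn , finB
      ... | pl _ , _ , ()
      ... | start , _ , ()
      ... | end , _ , ()

      startIn : start ∈ xs
      startIn with initialInImage embPL t (proj₁ (proj₂ finalLeft))
      ... | a , aIn , initA with bundleSatisfied (parB E F) t aIn (startl a initA) refl
      ... | .start , sIn , refl = sIn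

      covers : ys ⊆ xs
      covers {pl _} = maximalOnImage embPL maxE t finalLeft ty xs⊆ys
      covers {pr _} = maximalOnImage embPR maxF t finalRight ty xs⊆ys
      covers {start} _ = startIn
      covers {end} _ = endIn

  -- A final event of E · F is final in F; the initial F-event of the trace
  -- needs a final E-event through a bundle Φ_E ↦ f.
  sequentialCase : FinalMaximal (seqB E F)
  sequentialCase t (inj₁ _ , _ , ())
  sequentialCase {xs} t (inj₂ f , fIn , finF) {ys} ty xs⊆ys = covers
    where
      finalLeft : ∃ λ a → inj₁ a ∈ xs × E.fin a
      finalLeft with initialInImage embSR t fIn
      ... | f' , f'In , initF' with bundleSatisfied (seqB E F) t f'In (link f' initF') refl
      ... | inj₁ a , aIn , finA = a , aIn , finA
      ... | inj₂ _ , _ , ()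

      covers : ys ⊆ xs
      covers {inj₁ _} = maximalOnImage embSL maxE t finalLeft ty xs⊆ys
      covers {inj₂ _} = maximalOnImage embSR maxF t (f , fIn , finF) ty xs⊆ys

  -- A trace of E + F stays on one side, since initial events of E and F conflict.
  alternativeExclusive : ∀ {ys} → BES.Trace (altB E F) ys → ∀ {a b} →
                         inj₁ a ∈ ys → inj₂ b ∈ ys → ⊥
  alternativeExclusive =
    exclusiveImages embAL embAR (λ ia ib → inj₁ (ia , ib) , inj₁ (ia , ib)) (λ ())

  alternativeCase : FinalMaximal (altB E F)
  alternativeCase t (inj₁ a , aIn , finA) ty xs⊆ys {inj₁ _} =
    maximalOnImage embAL maxE t (a , aIn , finA) ty xs⊆ys
  alternativeCase t (inj₁ a , aIn , finA) ty xs⊆ys {inj₂ _} bIn =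
    ⊥-elim (alternativeExclusive ty (xs⊆ys aIn) bIn)
  alternativeCase t (inj₂ b , bIn , finB) ty xs⊆ys {inj₁ _} aIn =
    ⊥-elim (alternativeExclusive ty aIn (xs⊆ys bIn))
  alternativeCase t (inj₂ b , bIn , finB) ty xs⊆ys {inj₂ _} =
    maximalOnImage embAR maxF t (b , bIn , finB) ty xs⊆ys

  depth : StarEv E F → ℕ
  depth (cE d _) = d
  depth (cF d _) = d

  FinalEAt : ℕ → List (StarEv E F) → Set
  FinalEAt k zs = ∃ λ a → cE k a ∈ zs × E.fin a

  -- At one depth the initial E- and F-copies conflict, so they exclude each other.
  sameDepthExclusive : ∀ {zs} → BES.Trace (starB E F) zs → ∀ {k a g} →
                       cE k a ∈ zs → cF k g ∈ zs → ⊥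
  sameDepthExclusive ty {k} =
    exclusiveImages (embStE k) (embStF k) (λ ia ig → (refl , ia , ig) , (refl , ia , ig)) (λ ()) ty

  finalBeneath : ∀ {zs} → BES.Trace (starB E F) zs → ∀ {k e} → e ∈ zs →
                 depth e ≡ suc k → FinalEAt k zs
  finalBeneath t {k} {cE _ _} eIn refl with initialInImage (embStE (suc k)) t eIn
  ... | a , aIn , initA with bundleSatisfied (starB E F) t aIn (linkE k a initA) refl
  ... | cE .k e , e'In , (refl , finE) = e , e'In , finE
  ... | cF _ _ , _ , ()
  finalBeneath t {k} {cF _ _} eIn refl with initialInImage (embStF (suc k)) t eIn
  ... | g , gIn , initG with bundleSatisfied (starB E F) t gIn (linkF k g initG) refl
  ... | cE .k e , e'In , (refl , finE) = e , e'In , finE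
  ... | cF _ _ , _ , ()

  finalBelow : ∀ {zs} → BES.Trace (starB E F) zs → ∀ n {e} → e ∈ zs → depth e ≡ n →
               ∀ {k} → k < n → FinalEAt k zs
  finalBelow t (suc n) eIn eq (s≤s k≤n) with finalBeneath t eIn eq | m≤n⇒m<n∨m≡n k≤n
  ... | final | inj₂ refl = final
  ... | a , aIn , _ | inj₁ k<n = finalBelow t n aIn refl k<n

  -- If the final event f sits at depth d, the depths below d are settled by the
  -- final E-copies there, depth d by f itself, and an extension cannot reach
  -- depth d with an E-copy or go deeper, as both would put an E-copy next to f.
  starCase : FinalMaximal (starB E F)
  starCase t (cE _ _ , _ , ())
  starCase {xs} t (cF d f , fIn , finF) {ys} ty xs⊆ys = covers
    where
      noEAtDepth : ∀ {a} → cE d a ∈ ys → ⊥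
      noEAtDepth aIn = sameDepthExclusive ty aIn (xs⊆ys fIn)

      notDeeper : ∀ {e} → e ∈ ys → d < depth e → ⊥
      notDeeper eIn d<k = noEAtDepth (proj₁ (proj₂ (finalBelow ty _ eIn refl d<k)))

      finalEBelow : ∀ {k} → k < d → FinalEAt k xs
      finalEBelow = finalBelow t d fIn refl

      covers : ys ⊆ xs
      covers {cE k a} aIn with <-cmp k d
      ... | tri< k<d _ _  = maximalOnImage (embStE k) maxE t (finalEBelow k<d) ty xs⊆ys aIn
      ... | tri≈ _ refl _ = ⊥-elim (noEAtDepth aIn)
      ... | tri> _ _ d<k  = ⊥-elim (notDeeper aIn d<k)
      covers {cF k g} gIn with <-cmp k d
      ... | tri< k<d _ _  =
        ⊥-elim (sameDepthExclusive ty (xs⊆ys (proj₁ (proj₂ (finalEBelow k<d)))) gIn)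
      ... | tri≈ _ refl _ = maximalOnImage (embStF d) maxF t (f , fIn , finF) ty xs⊆ys gIn
      ... | tri> _ _ d<k  = ⊥-elim (notDeeper gIn d<k)

-- Every regular BES has the property, by induction on its expression; in the
-- one-event structures 1 and a the final event is the only event.
finalMaximal : ∀ {A} (r : RegExp A) → FinalMaximal ⟦ r ⟧
finalMaximal 𝟘 _ (() , _)
finalMaximal 𝟙 _ (_ , eIn , _) _ _ _ = eIn
finalMaximal (act _) _ (_ , eIn , _) _ _ _ = eIn
finalMaximal (r ‖ s) = Compositions.parallelCase ⟦ r ⟧ ⟦ s ⟧ (finalMaximal r) (finalMaximal s)
finalMaximal (r · s) = Compositions.sequentialCase ⟦ r ⟧ ⟦ s ⟧ (finalMaximal r) (finalMaximal s)
finalMaximal (r ⊕ s) = Compositions.alternativeCase ⟦ r ⟧ ⟦ s ⟧ (finalMaximal r) (finalMaximal s)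
finalMaximal (r ⊛ s) = Compositions.starCase ⟦ r ⟧ ⟦ s ⟧ (finalMaximal r) (finalMaximal s)

-- Configurations are the event sets of traces, so maximality transfers from
-- the trace xs representing x to x itself.
proposition19 : {A : Set} (r : RegExp A) →
    let ℰ = ⟦ r ⟧ in
    (x : BES.Ev ℰ → Set) → BES.IsConfig ℰ x →
    (∃ λ e → x e × BES.fin ℰ e) →
    BES.MaximalConfig ℰ x
proposition19 r x configX@(xs , tx , xIff) (e , xe , finE) = configX , maximal
  where
    maximal : ∀ y → BES.IsConfig ⟦ r ⟧ y → (∀ e → x e → y e) → ∀ e → y e → x e
    maximal y (ys , ty , yIff) x⊆y e' ye' =
      proj₂ (xIff e') (finalMaximal r tx (e , proj₁ (xIff e) xe , finE) ty
                         (λ {e''} m → proj₁ (yIff e'') (x⊆y e'' (proj₂ (xIff e'') m)))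
                         (proj₁ (yIff e') ye'))
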